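{- Fix $\leftthreetimes\in\{\cap,\subset\}$. There is no coproduct $\delta$ on $\mathcal{F}[\mathbf{H}]$ making $(\mathcal{F}[\mathbf{H}],m,\Delta^{(\subset,\cap)},\delta)$ a double bialgebra and of the form $\delta(G)=\sum_{\sim\in\mathcal{E}'[G]}G/\sim\otimes G\mid_\leftthreetimes\sim$ for every hypergraph $G$, where for each hypergraph $G$, $\mathcal{E}'[G]$ is a set of equivalence relations on $V(G)$.
   Context: $\mathbb{K}$ is a field of characteristic zero. A hypergraph is a pair $G=(V(G),E(G))$ with $V(G)$ finite and $E(G)\subseteq\mathcal{P}(V(G))$ containing $\emptyset$ and all singletons. For $I\subseteq V(G)$: $G_{\mid_\subset I}$ has vertex set $I$ and edges $\{e\in E(G)\mid e\subseteq I\}$; $G_{\mid_\cap I}$ has vertex set $I$ and edges $\{e\cap I\mid e\in E(G)\}$. $\mathcal{F}[\mathbf{H}]$ is the $\mathbb{K}$-vector space with basis the isomorphism classes of hypergraphs, with product $m$ the disjoint union ($GG'$: vertex set $V(G)\sqcup V(G')$, edges $E(G)\cup E(G')$) and coproduct $\Delta^{(\subset,\cap)}(G)=\sum_{I\subseteq V(G)}G_{\mid_\subset I}\otimes G_{\mid_\cap V(G)\setminus I}$. For an equivalence $\sim$ on $V(G)$ with canonical surjection $\pi_\sim$: $G/\sim$ has vertex set $V(G)/\sim$ and edges $\{\pi_\sim(e)\mid e\in E(G)\}$; $G\mid_\leftthreetimes\sim=\prod_{C\in V(G)/\sim}G_{\mid_\leftthreetimes C}$. A double bialgebra $(A,m,\Delta,\delta)$: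 $(A,m,\delta)$ and $(A,m,\Delta)$ are bialgebras, $(\Delta\otimes\mathrm{Id})\circ\delta=m_{1,3,24}\circ(\delta\otimes\delta)\circ\Delta$ with $m_{1,3,24}(a_1\otimes a_2\otimes a_3\otimes a_4)=a_1\otimes a_3\otimes a_2a_4$, and $(\varepsilon_\Delta\otimes\mathrm{Id})\circ\delta=1_A\varepsilon_\Delta$. -}

module Defs where

open import Level using (Level; _⊔_)
open import Data.Bool using (Bool; true; false; _∧_; _∨_; not; if_then_else_)
open import Data.Nat as ℕ using (ℕ; zero; suc)
open import Data.Fin as Fin using (Fin; toℕ)
open import Data.Vec as Vec using (Vec; []; _∷_; tabulate; take; drop)
open import Data.Bool.ListAction using (any; all)
open import Data.List as List using (List; []; _∷_; [_]; _++_; map; concatMap; allFin; length; filterᵇ; foldr)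
open import Data.Product using (_×_; _,_; Σ; ∃)
open import Relation.Nullary using (¬_; yes; no)
open import Relation.Nullary.Decidable using (⌊_⌋)
open import Relation.Binary.PropositionalEquality using (_≡_; refl)
open import Algebra.Bundles using (CommutativeRing)

module _ {c ℓ : Level} (K : CommutativeRing c ℓ) where
  open CommutativeRing K

  ⟦_⟧ℕ : ℕ → Carrier
  ⟦ zero ⟧ℕ  = 0#
  ⟦ suc n ⟧ℕ = 1# + ⟦ n ⟧ℕ

  record IsFieldCharZero : Set (c ⊔ ℓ) where
    field
      1≉0      : ¬ (1# ≈ 0#)
      inverse  : ∀ x → ¬ (x ≈ 0#) → ∃ λ y → x * y ≈ 1#
      charZero : ∀ n → ¬ (⟦ suc n ⟧ℕ ≈ 0#)

_==ᶠ_ : ∀ {n} → Fin n → Fin n → Bool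
i ==ᶠ j = ⌊ i Fin.≟ j ⌋

_==ᵇ_ : Bool → Bool → Bool
true  ==ᵇ b = b
false ==ᵇ b = not b

_⇒ᵇ_ : Bool → Bool → Bool
a ⇒ᵇ b = not a ∨ b

vecEq : ∀ {n} → Vec Bool n → Vec Bool n → Bool
vecEq {n} u v = all (λ i → Vec.lookup u i ==ᵇ Vec.lookup v i) (allFin n)

allVecs : ∀ {a} {A : Set a} → List A → (n : ℕ) → List (Vec A n)
allVecs xs zero    = [ [] ]
allVecs xs (suc n) = concatMap (λ x → map (x ∷_) (allVecs xs n)) xs

SubsetB : ℕ → Set
SubsetB n = Vec Bool n

allSubsets : (n : ℕ) → List (SubsetB n)
allSubsets n = allVecs (true ∷ false ∷ []) n

complementB : ∀ {n} → SubsetB n → SubsetB n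
complementB = Vec.map not

countTrue : ∀ {n} → SubsetB n → ℕ
countTrue []          = 0
countTrue (true ∷ v)  = suc (countTrue v)
countTrue (false ∷ v) = countTrue v

atMostOne : ∀ {n} → SubsetB n → Bool
atMostOne v = ⌊ countTrue v ℕ.≤? 1 ⌋

isEmptyB : ∀ {n} → SubsetB n → Bool
isEmptyB v = all not (Vec.toList v)

image : ∀ {n m} → (Fin n → Fin m) → SubsetB n → SubsetB m
image {n} f e = tabulate (λ j → any (λ i → Vec.lookup e i ∧ (f i ==ᶠ j)) (allFin n))

preimage : ∀ {n m} → (Fin n → Fin m) → SubsetB m → SubsetB n
preimage f e = tabulate (λ i → Vec.lookup e (f i))

elems : ∀ {n} → SubsetB n → List (Fin n)
elems {n} I = filterᵇ (Vec.lookup I) (allFin n)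

-- A hypergraph on the vertex set Fin size is coded by a Boolean predicate
-- `raw` on subsets; its edge set is `raw` closed under adding the empty set
-- and all singletons (so every code denotes a hypergraph in the paper's
-- sense, and every hypergraph with vertex set Fin n has a code).

record Hyp : Set where
  constructor hyp
  field
    size : ℕ
    raw  : SubsetB size → Bool
open Hyp public

isEdge : (G : Hyp) → SubsetB (size G) → Bool
isEdge G e = raw G e ∨ atMostOne e

injectiveB : ∀ {n} → (Fin n → Fin n) → Bool
injectiveB {n} f = all (λ i → all (λ j → (f i ==ᶠ f j) ⇒ᵇ (i ==ᶠ j)) (allFin n)) (allFin n)

isoSame : (n : ℕ) → (SubsetB n → Bool) → (SubsetB n → Bool) → Bool
isoSame n E E' =
  any (λ v → injectiveB (Vec.lookup v)
             ∧ all (λ e → E e ==ᵇ E' (image (Vec.lookup v) e)) (allSubsets n))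
      (allVecs (allFin n) n)

iso? : Hyp → Hyp → Bool
iso? (hyp n E) (hyp m E') with n ℕ.≟ m
... | yes refl = isoSame n (isEdge (hyp n E)) (isEdge (hyp n E'))
... | no _     = false

𝟙 : Hyp
𝟙 = hyp 0 (λ _ → false)

_·_ : Hyp → Hyp → Hyp
hyp n E · hyp m E' = hyp (n ℕ.+ m) (λ e →
     (isEdge (hyp n E) (take n e) ∧ isEmptyB (drop n e))
   ∨ (isEmptyB (take n e) ∧ isEdge (hyp m E') (drop n e)))

restrict⊂ : (G : Hyp) → SubsetB (size G) → Hyp
restrict⊂ G I = hyp (length (elems I)) (λ e' → isEdge G (image (List.lookup (elems I)) e'))

restrict∩ : (G : Hyp) → SubsetB (size G) → Hyp
restrict∩ G I = hyp (length (elems I)) (λ e' →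
  any (λ e → isEdge G e ∧ vecEq (preimage (List.lookup (elems I)) e) e') (allSubsets (size G)))

data Choice : Set where
  cap sub : Choice

restrictWith : Choice → (G : Hyp) → SubsetB (size G) → Hyp
restrictWith cap = restrict∩
restrictWith sub = restrict⊂

RelB : ℕ → Set
RelB n = Vec (Vec Bool n) n

relAt : ∀ {n} → RelB n → Fin n → Fin n → Bool
relAt R i j = Vec.lookup (Vec.lookup R i) j

isEquivB : ∀ {n} → RelB n → Bool
isEquivB {n} R =
     all (λ i → relAt R i i) (allFin n)
   ∧ all (λ i → all (λ j → relAt R i j ⇒ᵇ relAt R j i) (allFin n)) (allFin n)
   ∧ all (λ i → all (λ j → all (λ k → (relAt R i j ∧ relAt R j k) ⇒ᵇ relAt R i k)
                                (allFin n)) (allFin n)) (allFin n)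

allRels : (n : ℕ) → List (RelB n)
allRels n = allVecs (allSubsets n) n

reps : ∀ {n} → RelB n → List (Fin n)
reps {n} R = filterᵇ (λ i → all (λ j → ⌊ toℕ j ℕ.<? toℕ i ⌋ ⇒ᵇ not (relAt R j i)) (allFin n)) (allFin n)

classOf : ∀ {n} → RelB n → Fin n → SubsetB n
classOf R r = tabulate (λ i → relAt R i r)

quotientH : (G : Hyp) → RelB (size G) → Hyp
quotientH G R = hyp (length (reps R)) (λ e' →
  any (λ e → isEdge G e
           ∧ vecEq e' (tabulate (λ c → any (λ i → Vec.lookup e i ∧ relAt R i (List.lookup (reps R) c))
                                            (allFin (size G)))))
      (allSubsets (size G)))

restrictRel : Choice → (G : Hyp) → RelB (size G) → Hyp
restrictRel ch G R = foldr (λ r H → restrictWith ch G (classOf R r) · H) 𝟙 (reps R)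

-- An element of F[H]^{⊗k} is a finite formal combination of k-tuples of
-- hypergraphs; two are equal iff they have the same coefficient on every
-- k-tuple of isomorphism classes.

module FH {c ℓ : Level} (K : CommutativeRing c ℓ) where
  open CommutativeRing K

  Tensor : ℕ → Set c
  Tensor k = List (Carrier × Vec Hyp k)

  isoVec : ∀ {k} → Vec Hyp k → Vec Hyp k → Bool
  isoVec []       []       = true
  isoVec (G ∷ Gs) (H ∷ Hs) = iso? G H ∧ isoVec Gs Hs

  coeff : ∀ {k} → Tensor k → Vec Hyp k → Carrier
  coeff []             t = 0#
  coeff ((a , u) ∷ xs) t = (if isoVec u t then a else 0#) + coeff xs t

  _≋_ : ∀ {k} → Tensor k → Tensor k → Set ℓ
  x ≋ y = ∀ t → coeff x t ≈ coeff y t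

  pureT : ∀ {k} → Vec Hyp k → Tensor k
  pureT u = [ (1# , u) ]

  scaleT : ∀ {k} → Carrier → Tensor k → Tensor k
  scaleT a = map (λ { (b , u) → (a * b , u) })

  _⊗_ : ∀ {j k} → Tensor j → Tensor k → Tensor (j ℕ.+ k)
  x ⊗ y = concatMap (λ { (a , u) → map (λ { (b , v) → (a * b , u Vec.++ v) }) y }) x

  linT : ∀ {j k} → (Vec Hyp j → Tensor k) → Tensor j → Tensor k
  linT f = concatMap (λ { (a , u) → scaleT a (f u) })

  mulT : ∀ {k} → Tensor k → Tensor k → Tensor k
  mulT x y = concatMap (λ { (a , u) → map (λ { (b , v) → (a * b , Vec.zipWith _·_ u v) }) y }) x

  m1324 : Tensor 4 → Tensor 3
  m1324 = linT (λ { (a₁ ∷ a₂ ∷ a₃ ∷ a₄ ∷ []) → pureT (a₁ ∷ a₃ ∷ (a₂ · a₄) ∷ []) })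

  Coproduct : Set c
  Coproduct = Hyp → Tensor 2

  δ⊗Id : Coproduct → Tensor 2 → Tensor 3
  δ⊗Id d = linT (λ { (G₁ ∷ G₂ ∷ []) → d G₁ ⊗ pureT (G₂ ∷ []) })

  Id⊗δ : Coproduct → Tensor 2 → Tensor 3
  Id⊗δ d = linT (λ { (G₁ ∷ G₂ ∷ []) → pureT (G₁ ∷ []) ⊗ d G₂ })

  ε⊗Id : (Hyp → Carrier) → Tensor 2 → Tensor 1
  ε⊗Id e = linT (λ { (G₁ ∷ G₂ ∷ []) → [ (e G₁ , G₂ ∷ []) ] })

  Id⊗ε : (Hyp → Carrier) → Tensor 2 → Tensor 1
  Id⊗ε e = linT (λ { (G₁ ∷ G₂ ∷ []) → [ (e G₂ , G₁ ∷ []) ] })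

  δ⊗δ : Coproduct → Coproduct → Tensor 2 → Tensor 4
  δ⊗δ d d' = linT (λ { (G₁ ∷ G₂ ∷ []) → d G₁ ⊗ d' G₂ })

  record IsBialgebraWithCounit (D : Coproduct) (ε : Hyp → Carrier) : Set (c ⊔ ℓ) where
    field
      D-wellDefined : ∀ G H → iso? G H ≡ true → D G ≋ D H
      ε-wellDefined : ∀ G H → iso? G H ≡ true → ε G ≈ ε H
      coassoc       : ∀ G → δ⊗Id D (D G) ≋ Id⊗δ D (D G)
      counitˡ       : ∀ G → ε⊗Id ε (D G) ≋ pureT (G ∷ [])
      counitʳ       : ∀ G → Id⊗ε ε (D G) ≋ pureT (G ∷ [])
      D-mult        : ∀ G H → D (G · H) ≋ mulT (D G) (D H)
      D-unit        : D 𝟙 ≋ pureT (𝟙 ∷ 𝟙 ∷ [])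
      ε-mult        : ∀ G H → ε (G · H) ≈ ε G * ε H
      ε-unit        : ε 𝟙 ≈ 1#

  IsBialgebra : Coproduct → Set (c ⊔ ℓ)
  IsBialgebra D = Σ (Hyp → Carrier) (IsBialgebraWithCounit D)

  record IsDoubleBialgebra (Δ δ : Coproduct) : Set (c ⊔ ℓ) where
    field
      δ-bialgebra : IsBialgebra δ
      Δ-bialgebra : IsBialgebra Δ
      compat      : ∀ G → δ⊗Id Δ (δ G) ≋ m1324 (δ⊗δ δ δ (Δ G))
    εΔ : Hyp → Carrier
    εΔ = Data.Product.proj₁ Δ-bialgebra
    field
      εΔ-compat   : ∀ G → ε⊗Id εΔ (δ G) ≋ [ (εΔ G , 𝟙 ∷ []) ]

  Δ⊂∩ : Coproduct
  Δ⊂∩ G = map (λ I → (1# , restrict⊂ G I ∷ restrict∩ G (complementB I) ∷ []))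
              (allSubsets (size G))

  δFrom : Choice → ((G : Hyp) → RelB (size G) → Bool) → Coproduct
  δFrom ch E' G = map (λ R → (1# , quotientH G R ∷ restrictRel ch G R ∷ []))
                      (filterᵇ (λ R → isEquivB R ∧ E' G R) (allRels (size G)))

module Submission where

-- Compare the coefficients of point ⊗ point ⊗ edge⊔point on the two sides of the compatibility
-- (Δ ⊗ Id) ∘ δ = m₁,₃,₂₄ ∘ (δ ⊗ δ) ∘ Δ at hyperedge₃, the three-vertex hypergraph whose only
-- non-trivial edge is its vertex set. All coefficients involved are 1, so in characteristic zero
-- both sides contain equally many terms isomorphic to this tuple.
-- On the left each selected ∼ contributes Δ(G/∼) ⊗ G|⋉∼, and Δ(G/∼) contains point ⊗ point
-- twice or never, so the count is even.
-- On the right, of the terms G|⊂I ⊗ G|∩(V∖I) of Δ(G) only the three singletons I contribute,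
-- exactly once each, as soon as δ(point) and δ(G|∩(V∖I)) contain the term of the total relation.
-- The counit axiom forces this, the total relation being the only ∼ with G|⋉∼ ≅ G for these
-- two hypergraphs. So the count is 3, which is odd.

open import Defs
open import Level using (Level; _⊔_)
open import Function using (_∘_)
open import Function.Bundles using (Equivalence)
open import Data.Bool using (Bool; true; false; T; not; _∧_; if_then_else_; T?)
open import Data.Bool.Properties using (T-∧; T-not-≡)
open import Data.Bool.ListAction using (any)
open import Data.Nat using (ℕ; zero; suc; _+_; _≡ᵇ_)
open import Data.Nat.Properties using (+-assoc; ≡ᵇ⇒≡)
open import Data.Nat.Divisibility using (_∣_; _∣?_)
open import Data.Nat.ListAction using (sum)
open import Data.Vec using (Vec; []; _∷_)
open import Data.List using (List; []; _∷_; _++_; map; filterᵇ; take)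
open import Data.List.Properties using (filter-accept; map-cong-local)
open import Data.List.Relation.Unary.All as All using (All; []; _∷_)
open import Data.List.Relation.Unary.All.Properties using (++⁺)
open import Data.Product using (_×_; _,_; proj₁; proj₂)
open import Data.Empty using (⊥-elim)
open import Relation.Nullary using (¬_)
open import Relation.Nullary.Decidable using (⌊_⌋; toWitness; toWitnessFalse)
open import Relation.Binary.PropositionalEquality
  using (_≡_; refl; sym; trans; cong; cong₂; subst)
open import Algebra.Bundles using (CommutativeRing)

filterᵇ-∧ : ∀ {a} {A : Set a} (p q : A → Bool) xs →
            filterᵇ (λ x → p x ∧ q x) xs ≡ filterᵇ q (filterᵇ p xs)
filterᵇ-∧ p q []       = refl
filterᵇ-∧ p q (x ∷ xs) with p x
... | false = filterᵇ-∧ p q xs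
... | true with q x
...   | true  = cong (x ∷_) (filterᵇ-∧ p q xs)
...   | false = filterᵇ-∧ p q xs

everySublist? : ∀ {a} {A : Set a} → List A → (List A → Bool) → Bool
everySublist? []       P = P []
everySublist? (x ∷ xs) P = everySublist? xs (P ∘ (x ∷_)) ∧ everySublist? xs P

everySublist?-sound : ∀ {a} {A : Set a} xs (P : List A → Bool) →
                      T (everySublist? xs P) → ∀ q → T (P (filterᵇ q xs))
everySublist?-sound []       P h q = h
everySublist?-sound (x ∷ xs) P h q with Equivalence.to T-∧ h | q x
... | h₁ , _ | true  = everySublist?-sound xs (P ∘ (x ∷_)) h₁ q
... | _ , h₂ | false = everySublist?-sound xs P h₂ q

everySublistWithHead? : ∀ {a} {A : Set a} → List A → (List A → Bool) → Bool
everySublistWithHead? []       P = P []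
everySublistWithHead? (x ∷ xs) P = everySublist? xs (P ∘ (x ∷_))

everySublistWithoutHead? : ∀ {a} {A : Set a} → List A → (List A → Bool) → Bool
everySublistWithoutHead? []       P = true
everySublistWithoutHead? (x ∷ xs) P = everySublist? xs P

everySublistWithHead?-sound : ∀ {a} {A : Set a} xs (P : List A → Bool) →
  T (everySublistWithHead? xs P) → ∀ q → All (T ∘ q) (take 1 xs) → T (P (filterᵇ q xs))
everySublistWithHead?-sound []       P h q []        = h
everySublistWithHead?-sound (x ∷ xs) P h q (qx ∷ []) =
  subst (T ∘ P) (sym (filter-accept (T? ∘ q) qx)) (everySublist?-sound xs (P ∘ (x ∷_)) h q)

head-selected : ∀ {a} {A : Set a} xs (P : List A → Bool) q →
  T (P (filterᵇ q xs)) → T (everySublistWithoutHead? xs (not ∘ P)) → All (T ∘ q) (take 1 xs)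
head-selected []       P q _ _ = []
head-selected (x ∷ xs) P q holds failsWithoutHead with q x in qx
... | true  = subst T (sym qx) _ ∷ []
... | false = ⊥-elim (subst T fails holds)
  where
  fails : P (filterᵇ q xs) ≡ false
  fails = Equivalence.to T-not-≡ (everySublist?-sound xs (not ∘ P) failsWithoutHead q)

everySublist²? : ∀ {a b} {A : Set a} {B : Set b} → List A → List B → (List A → List B → Bool) → Bool
everySublist²? xs ys P = everySublist? xs (everySublist? ys ∘ P)

everySublist²?-sound : ∀ {a b} {A : Set a} {B : Set b} xs ys (P : List A → List B → Bool) →
  T (everySublist²? xs ys P) → ∀ p q → T (P (filterᵇ p xs) (filterᵇ q ys))
everySublist²?-sound xs ys P h p q =
  everySublist?-sound ys (P (filterᵇ p xs)) (everySublist?-sound xs (everySublist? ys ∘ P) h p) q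

everySublistWithHead²? : ∀ {a b} {A : Set a} {B : Set b} →
  List A → List B → (List A → List B → Bool) → Bool
everySublistWithHead²? xs ys P = everySublistWithHead? xs (everySublistWithHead? ys ∘ P)

everySublistWithHead²?-sound : ∀ {a b} {A : Set a} {B : Set b} xs ys (P : List A → List B → Bool) →
  T (everySublistWithHead²? xs ys P) → ∀ p q → All (T ∘ p) (take 1 xs) → All (T ∘ q) (take 1 ys) →
  T (P (filterᵇ p xs) (filterᵇ q ys))
everySublistWithHead²?-sound xs ys P h p q p₁ q₁ =
  everySublistWithHead?-sound ys (P (filterᵇ p xs))
    (everySublistWithHead?-sound xs (everySublistWithHead? ys ∘ P) h p p₁) q q₁

module Counting {c ℓ : Level} (K : CommutativeRing c ℓ) where
  open CommutativeRing K
    using (Carrier; _≈_; _*_; 0#; 1#; setoid; +-group; +-cong; +-identityˡ; +-identityʳ;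
           *-cong; *-identityˡ)
    renaming (refl to ≈-refl; sym to ≈-sym; trans to ≈-trans)
  open import Algebra.Properties.Group +-group using (∙-cancelˡ)
  open import Relation.Binary.Reasoning.Setoid setoid
  open FH K

  ⟦_⟧ : ℕ → Carrier
  ⟦_⟧ = ⟦_⟧ℕ K

  ⟦⟧-injective : IsFieldCharZero K → ∀ m n → ⟦ m ⟧ ≈ ⟦ n ⟧ → m ≡ n
  ⟦⟧-injective F zero    zero    _ = refl
  ⟦⟧-injective F zero    (suc n) e = ⊥-elim (IsFieldCharZero.charZero F n (≈-sym e))
  ⟦⟧-injective F (suc m) zero    e = ⊥-elim (IsFieldCharZero.charZero F m e)
  ⟦⟧-injective F (suc m) (suc n) e = cong suc (⟦⟧-injective F m n (∙-cancelˡ 1# ⟦ m ⟧ ⟦ n ⟧ e))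

  basisSum : ∀ {k} → (Vec Hyp k → ℕ) → Tensor k → ℕ
  basisSum h []            = 0
  basisSum h ((_ , u) ∷ x) = h u + basisSum h x

  multiplicity : ∀ {k} → Tensor k → Vec Hyp k → ℕ
  multiplicity x t = basisSum (λ u → if isoVec u t then 1 else 0) x

  basisSum-cong : ∀ {k} {h h′ : Vec Hyp k → ℕ} → (∀ u → h u ≡ h′ u) →
                  ∀ x → basisSum h x ≡ basisSum h′ x
  basisSum-cong h≡h′ []            = refl
  basisSum-cong h≡h′ ((_ , u) ∷ x) = cong₂ _+_ (h≡h′ u) (basisSum-cong h≡h′ x)

  basisSum-++ : ∀ {k} (h : Vec Hyp k → ℕ) x y → basisSum h (x ++ y) ≡ basisSum h x + basisSum h y
  basisSum-++ h []            y = refl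
  basisSum-++ h ((_ , u) ∷ x) y =
    trans (cong (h u +_) (basisSum-++ h x y)) (sym (+-assoc (h u) (basisSum h x) (basisSum h y)))

  basisSum-scaleT : ∀ {k} (h : Vec Hyp k → ℕ) a x → basisSum h (scaleT a x) ≡ basisSum h x
  basisSum-scaleT h a []            = refl
  basisSum-scaleT h a ((_ , u) ∷ x) = cong (h u +_) (basisSum-scaleT h a x)

  basisSum-linT : ∀ {j k} (h : Vec Hyp k → ℕ) (f : Vec Hyp j → Tensor k) x →
                  basisSum h (linT f x) ≡ basisSum (basisSum h ∘ f) x
  basisSum-linT h f []            = refl
  basisSum-linT h f ((a , u) ∷ x) =
    trans (basisSum-++ h (scaleT a (f u)) (linT f x))
          (cong₂ _+_ (basisSum-scaleT h a (f u)) (basisSum-linT h f x))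

  multiplicity-m1324-δ⊗δ : ∀ (d : Coproduct) x t →
    multiplicity (m1324 (δ⊗δ d d x)) t
      ≡ basisSum (λ { (G₁ ∷ G₂ ∷ []) → multiplicity (m1324 (d G₁ ⊗ d G₂)) t }) x
  multiplicity-m1324-δ⊗δ d x t =
    trans (basisSum-linT _ _ (δ⊗δ d d x))
   (trans (basisSum-linT _ _ x)
          (basisSum-cong (λ { (G₁ ∷ G₂ ∷ []) → sym (basisSum-linT _ _ (d G₁ ⊗ d G₂)) }) x))

  UnitCoefficients : ∀ {k} → Tensor k → Set (c ⊔ ℓ)
  UnitCoefficients = All (λ p → proj₁ p ≈ 1#)

  UnitCoefficients-map : ∀ {j k} (F : Carrier × Vec Hyp j → Carrier × Vec Hyp k) →
    (∀ b v → b ≈ 1# → proj₁ (F (b , v)) ≈ 1#) →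
    ∀ y → UnitCoefficients y → UnitCoefficients (map F y)
  UnitCoefficients-map F F1 []            []       = []
  UnitCoefficients-map F F1 ((b , v) ∷ y) (p ∷ ps) = F1 b v p ∷ UnitCoefficients-map F F1 y ps

  UnitCoefficients-fromList : ∀ {a} {A : Set a} {k} (f : A → Vec Hyp k) xs →
                              UnitCoefficients (map (λ x → (1# , f x)) xs)
  UnitCoefficients-fromList f []       = []
  UnitCoefficients-fromList f (x ∷ xs) = ≈-refl ∷ UnitCoefficients-fromList f xs

  1*1≈1 : ∀ {a b} → a ≈ 1# → b ≈ 1# → a * b ≈ 1#
  1*1≈1 a≈1 b≈1 = ≈-trans (*-cong a≈1 b≈1) (*-identityˡ 1#)

  UnitCoefficients-⊗ : ∀ {j k} (x : Tensor j) (y : Tensor k) →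
    UnitCoefficients x → UnitCoefficients y → UnitCoefficients (x ⊗ y)
  UnitCoefficients-⊗ []            y []       uy = []
  UnitCoefficients-⊗ ((a , u) ∷ x) y (p ∷ ux) uy =
    ++⁺ (UnitCoefficients-map _ (λ _ _ → 1*1≈1 p) y uy) (UnitCoefficients-⊗ x y ux uy)

  UnitCoefficients-linT : ∀ {j k} (f : Vec Hyp j → Tensor k) → (∀ u → UnitCoefficients (f u)) →
    ∀ x → UnitCoefficients x → UnitCoefficients (linT f x)
  UnitCoefficients-linT f uf []            []       = []
  UnitCoefficients-linT f uf ((a , u) ∷ x) (p ∷ ux) =
    ++⁺ (UnitCoefficients-map _ (λ _ _ → 1*1≈1 p) (f u) (uf u)) (UnitCoefficients-linT f uf x ux)

  UnitCoefficients-Δ⊂∩ : ∀ G → UnitCoefficients (Δ⊂∩ G)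
  UnitCoefficients-Δ⊂∩ G = UnitCoefficients-fromList _ (allSubsets (size G))

  UnitCoefficients-m1324 : ∀ x → UnitCoefficients x → UnitCoefficients (m1324 x)
  UnitCoefficients-m1324 = UnitCoefficients-linT _ (λ { (_ ∷ _ ∷ _ ∷ _ ∷ []) → ≈-refl ∷ [] })

  UnitCoefficients-δ⊗Id : ∀ d → (∀ G → UnitCoefficients (d G)) →
    ∀ x → UnitCoefficients x → UnitCoefficients (δ⊗Id d x)
  UnitCoefficients-δ⊗Id d ud = UnitCoefficients-linT _
    (λ { (G₁ ∷ G₂ ∷ []) → UnitCoefficients-⊗ (d G₁) (pureT (G₂ ∷ [])) (ud G₁) (≈-refl ∷ []) })

  UnitCoefficients-δ⊗δ : ∀ d → (∀ G → UnitCoefficients (d G)) →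
    ∀ x → UnitCoefficients x → UnitCoefficients (δ⊗δ d d x)
  UnitCoefficients-δ⊗δ d ud = UnitCoefficients-linT _
    (λ { (G₁ ∷ G₂ ∷ []) → UnitCoefficients-⊗ (d G₁) (d G₂) (ud G₁) (ud G₂) })

  coeff≈⟦multiplicity⟧ : ∀ {k} (x : Tensor k) t → UnitCoefficients x → coeff x t ≈ ⟦ multiplicity x t ⟧
  coeff≈⟦multiplicity⟧ []            t []       = ≈-refl
  coeff≈⟦multiplicity⟧ ((a , u) ∷ x) t (p ∷ ux) with isoVec u t
  ... | true  = +-cong p (coeff≈⟦multiplicity⟧ x t ux)
  ... | false = ≈-trans (+-identityˡ _) (coeff≈⟦multiplicity⟧ x t ux)

  ≋⇒multiplicity≡ : IsFieldCharZero K → ∀ {k} {x y : Tensor k} →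
    UnitCoefficients x → UnitCoefficients y → x ≋ y → ∀ t → multiplicity x t ≡ multiplicity y t
  ≋⇒multiplicity≡ F {x = x} {y} ux uy x≋y t = ⟦⟧-injective F _ _ (begin
    ⟦ multiplicity x t ⟧ ≈⟨ coeff≈⟦multiplicity⟧ x t ux ⟨
    coeff x t            ≈⟨ x≋y t ⟩
    coeff y t            ≈⟨ coeff≈⟦multiplicity⟧ y t uy ⟩
    ⟦ multiplicity y t ⟧ ∎)

  rightFactorOccurs : Hyp → Tensor 2 → Bool
  rightFactorOccurs G = any (λ { (_ , _ ∷ G₂ ∷ []) → iso? G₂ G })

  coeff-ε⊗Id≈0 : ∀ e x G → T (not (rightFactorOccurs G x)) → coeff (ε⊗Id e x) (G ∷ []) ≈ 0#
  coeff-ε⊗Id≈0 e []                          G _ = ≈-refl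
  coeff-ε⊗Id≈0 e ((a , G₁ ∷ G₂ ∷ []) ∷ x) G h with iso? G₂ G
  ... | false = ≈-trans (+-identityˡ _) (coeff-ε⊗Id≈0 e x G h)

  coeff-pureT-self : ∀ G → T (iso? G G) → coeff (pureT (G ∷ [])) (G ∷ []) ≈ 1#
  coeff-pureT-self G h with iso? G G
  ... | true = +-identityʳ 1#

  counit⇒rightFactorOccurs : ¬ 1# ≈ 0# → ∀ {D ε} → IsBialgebraWithCounit D ε →
    ∀ G → T (iso? G G) → T (rightFactorOccurs G (D G))
  counit⇒rightFactorOccurs 1≉0 {D} {ε} B G G≅G with rightFactorOccurs G (D G) in absent
  ... | true  = _
  ... | false = ⊥-elim (1≉0 (begin
    1#                             ≈⟨ coeff-pureT-self G G≅G ⟨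
    coeff (pureT (G ∷ [])) (G ∷ []) ≈⟨ IsBialgebraWithCounit.counitˡ B G (G ∷ []) ⟨
    coeff (ε⊗Id ε (D G)) (G ∷ [])  ≈⟨ coeff-ε⊗Id≈0 ε (D G) G (subst (T ∘ not) (sym absent) _) ⟩
    0#                             ∎))

module RelationCoproducts {c ℓ : Level} (K : CommutativeRing c ℓ) where
  open CommutativeRing K using (_≈_; 0#; 1#)
  open FH K
  open Counting K

  equivalences : (n : ℕ) → List (RelB n)
  equivalences n = filterᵇ isEquivB (allRels n)

  δOn : Choice → (G : Hyp) → List (RelB (size G)) → Tensor 2
  δOn ch G = map (λ R → (1# , quotientH G R ∷ restrictRel ch G R ∷ []))

  δFrom≡δOn : ∀ ch E' G → δFrom ch E' G ≡ δOn ch G (filterᵇ (E' G) (equivalences (size G)))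
  δFrom≡δOn ch E' G = cong (δOn ch G) (filterᵇ-∧ isEquivB (E' G) (allRels (size G)))

  UnitCoefficients-δFrom : ∀ ch E' G → UnitCoefficients (δFrom ch E' G)
  UnitCoefficients-δFrom ch E' G =
    UnitCoefficients-fromList _ (filterᵇ (λ R → isEquivB R ∧ E' G R) (allRels (size G)))

  -- The first equivalence relation enumerated is the total one ∼, for which G|⋉∼ = G.
  firstOnlyRestores : Choice → Hyp → Bool
  firstOnlyRestores ch G =
    iso? G G ∧ everySublistWithoutHead? (equivalences (size G)) (not ∘ rightFactorOccurs G ∘ δOn ch G)

  counit-selects-first : ∀ ch E' {ε} → IsBialgebraWithCounit (δFrom ch E') ε → ¬ 1# ≈ 0# →
    ∀ G → T (firstOnlyRestores ch G) → All (T ∘ E' G) (take 1 (equivalences (size G)))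
  counit-selects-first ch E' B 1≉0 G onlyFirst =
    head-selected (equivalences (size G)) (rightFactorOccurs G ∘ δOn ch G) (E' G)
      (subst (T ∘ rightFactorOccurs G) (δFrom≡δOn ch E' G) (counit⇒rightFactorOccurs 1≉0 B G G≅G))
      failsWithoutFirst
    where
    G≅G = proj₁ (Equivalence.to T-∧ onlyFirst)
    failsWithoutFirst = proj₂ (Equivalence.to T-∧ onlyFirst)

point : Hyp
point = hyp 1 (λ _ → false)

hyperedge₃ : Hyp
hyperedge₃ = hyp 3 (λ e → vecEq e (true ∷ true ∷ true ∷ []))

edge⊔point : Hyp
edge⊔point = hyp 3 (λ e → vecEq e (true ∷ true ∷ false ∷ []))

target : Vec Hyp 3
target = point ∷ point ∷ edge⊔point ∷ []

Δ₁ Δ₂ : SubsetB 3 → Hyp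
Δ₁ I = restrict⊂ hyperedge₃ I
Δ₂ I = restrict∩ hyperedge₃ (complementB I)

isSingleton : SubsetB 3 → Bool
isSingleton I = countTrue I ≡ᵇ 1

module Computations {c ℓ : Level} (K : CommutativeRing c ℓ) where
  open FH K
  open Counting K
  open RelationCoproducts K

  lhsCount : Choice → List (RelB 3) → ℕ
  lhsCount ch Rs = multiplicity (δ⊗Id Δ⊂∩ (δOn ch hyperedge₃ Rs)) target

  rhsTerm : Choice → (I : SubsetB 3) → List (RelB (size (Δ₁ I))) → List (RelB (size (Δ₂ I))) → ℕ
  rhsTerm ch I Rs Ss = multiplicity (m1324 (δOn ch (Δ₁ I) Rs ⊗ δOn ch (Δ₂ I) Ss)) target

  lhsCheck : Choice → Bool
  lhsCheck ch = everySublist? (equivalences 3) (λ Rs → ⌊ 2 ∣? lhsCount ch Rs ⌋)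

  lhsCheck-holds : ∀ ch → T (lhsCheck ch)
  lhsCheck-holds cap = _
  lhsCheck-holds sub = _

  TermCountsOnce : Choice → SubsetB 3 → Set
  TermCountsOnce ch I =
    T (firstOnlyRestores ch (Δ₁ I)) × T (firstOnlyRestores ch (Δ₂ I))
    × T (everySublistWithHead²? (equivalences (size (Δ₁ I))) (equivalences (size (Δ₂ I)))
           (λ Rs Ss → rhsTerm ch I Rs Ss ≡ᵇ 1))

  TermVanishes : Choice → SubsetB 3 → Set
  TermVanishes ch I =
    T (everySublist²? (equivalences (size (Δ₁ I))) (equivalences (size (Δ₂ I)))
         (λ Rs Ss → rhsTerm ch I Rs Ss ≡ᵇ 0))

  RhsTermCheck : Choice → SubsetB 3 → Set
  RhsTermCheck ch I = if isSingleton I then TermCountsOnce ch I else TermVanishes ch I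

  rhsTermChecks-hold : ∀ ch → All (RhsTermCheck ch) (allSubsets 3)
  rhsTermChecks-hold cap = _ ∷ _ ∷ _ ∷ _ ∷ _ ∷ _ ∷ _ ∷ _ ∷ []
  rhsTermChecks-hold sub = _ ∷ _ ∷ _ ∷ _ ∷ _ ∷ _ ∷ _ ∷ _ ∷ []

module CompatibilityAtHyperedge₃ {c ℓ : Level} (K : CommutativeRing c ℓ) (F : IsFieldCharZero K)
                     (ch : Choice) (E' : (G : Hyp) → RelB (size G) → Bool)
                     (D : FH.IsDoubleBialgebra K (FH.Δ⊂∩ K) (FH.δFrom K ch E')) where
  open FH K
  open Counting K
  open RelationCoproducts K
  open Computations K
  open IsDoubleBialgebra D using (δ-bialgebra; compat)

  δ : Coproduct
  δ = δFrom ch E'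

  selected : (G : Hyp) → List (RelB (size G))
  selected G = filterᵇ (E' G) (equivalences (size G))

  counit-selects-first-of : ∀ G → T (firstOnlyRestores ch G) →
                            All (T ∘ E' G) (take 1 (equivalences (size G)))
  counit-selects-first-of = counit-selects-first ch E' (proj₂ δ-bialgebra) (IsFieldCharZero.1≉0 F)

  term : SubsetB 3 → ℕ
  term I = multiplicity (m1324 (δ (Δ₁ I) ⊗ δ (Δ₂ I))) target

  term≡rhsTerm : ∀ I → term I ≡ rhsTerm ch I (selected (Δ₁ I)) (selected (Δ₂ I))
  term≡rhsTerm I = cong₂ (λ x y → multiplicity (m1324 (x ⊗ y)) target)
                         (δFrom≡δOn ch E' (Δ₁ I)) (δFrom≡δOn ch E' (Δ₂ I))

  term-counts-once : ∀ I → TermCountsOnce ch I → term I ≡ 1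
  term-counts-once I (forced₁ , forced₂ , once) = trans (term≡rhsTerm I) (≡ᵇ⇒≡ _ 1
    (everySublistWithHead²?-sound (equivalences _) (equivalences _) (λ Rs Ss → rhsTerm ch I Rs Ss ≡ᵇ 1)
       once (E' (Δ₁ I)) (E' (Δ₂ I))
       (counit-selects-first-of (Δ₁ I) forced₁) (counit-selects-first-of (Δ₂ I) forced₂)))

  term-vanishes : ∀ I → TermVanishes ch I → term I ≡ 0
  term-vanishes I vanishes = trans (term≡rhsTerm I) (≡ᵇ⇒≡ _ 0
    (everySublist²?-sound (equivalences _) (equivalences _) (λ Rs Ss → rhsTerm ch I Rs Ss ≡ᵇ 0)
       vanishes (E' (Δ₁ I)) (E' (Δ₂ I))))

  term≡indicator : ∀ I → RhsTermCheck ch I → term I ≡ (if isSingleton I then 1 else 0)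
  term≡indicator I = by-cases (isSingleton I)
    where
    by-cases : ∀ b → (if b then TermCountsOnce ch I else TermVanishes ch I) →
               term I ≡ (if b then 1 else 0)
    by-cases true  = term-counts-once I
    by-cases false = term-vanishes I

  rhs-count : multiplicity (m1324 (δ⊗δ δ δ (Δ⊂∩ hyperedge₃))) target ≡ 3
  rhs-count = trans (multiplicity-m1324-δ⊗δ δ (Δ⊂∩ hyperedge₃) target)
            (cong sum (map-cong-local (All.map (λ {I} → term≡indicator I) (rhsTermChecks-hold ch))))

  lhs-even : 2 ∣ multiplicity (δ⊗Id Δ⊂∩ (δ hyperedge₃)) target
  lhs-even = subst (λ x → 2 ∣ multiplicity (δ⊗Id Δ⊂∩ x) target) (sym (δFrom≡δOn ch E' hyperedge₃))
               (toWitness (everySublist?-sound (equivalences 3) (λ Rs → ⌊ 2 ∣? lhsCount ch Rs ⌋)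
                                               (lhsCheck-holds ch) (E' hyperedge₃)))

  counts-agree : multiplicity (δ⊗Id Δ⊂∩ (δ hyperedge₃)) target
               ≡ multiplicity (m1324 (δ⊗δ δ δ (Δ⊂∩ hyperedge₃))) target
  counts-agree = ≋⇒multiplicity≡ F
    (UnitCoefficients-δ⊗Id Δ⊂∩ UnitCoefficients-Δ⊂∩ (δ hyperedge₃)
                           (UnitCoefficients-δFrom ch E' hyperedge₃))
    (UnitCoefficients-m1324 _ (UnitCoefficients-δ⊗δ δ (UnitCoefficients-δFrom ch E')
                                                    (Δ⊂∩ hyperedge₃) (UnitCoefficients-Δ⊂∩ hyperedge₃)))
    (compat hyperedge₃) target

corollary2p7 : {c ℓ : Level} (K : CommutativeRing c ℓ) → IsFieldCharZero K →
    (ch : Choice) (E' : (G : Hyp) → RelB (size G) → Bool) →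
    ¬ FH.IsDoubleBialgebra K (FH.Δ⊂∩ K) (FH.δFrom K ch E')
corollary2p7 K F ch E' D =
  toWitnessFalse {a? = 2 ∣? 3} _ (subst (2 ∣_) (trans counts-agree rhs-count) lhs-even)
  where open CompatibilityAtHyperedge₃ K F ch E' D
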